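{- Let $\ell, m, u, v$ be positive integers with $u \leq m$, and let $K$ be a set of integers, each at least $2$, with $\ell \in K$. Suppose there exist a TD$(\ell+1,m)$, a TD$(\ell,u)$, a $K$-GDD of type $u^{\ell} v^1$, and an $(mu+1,K)$-PBD. Then for every integer $t$ with $0 \leq t \leq m-u$ there exists a $K$-GDD of type $\ell^{mu}(tv+1)^1$.
   Context: For a set $K$ of positive integers (each at least $2$), a $K$-GDD (group-divisible design) is a triple $(X,\mathcal{G},\mathcal{A})$ where $X$ is a finite set of points, $\mathcal{G}$ is a partition of $X$ into groups, and $\mathcal{A}$ is a collection of subsets (blocks) of $X$ such that every block meets every group in at most one point, every pair of points from different groups lies in exactly one block, and every block has size in $K$. If $K=\{k\}$ we write $k$-GDD. The type of the GDD is the multiset of group sizes, written exponentially: type $t_1^{u_1} t_2^{u_2}\cdots$ means $u_i$ groups of size $t_i$. A TD$(k,n)$ (transversal design) is a $k$-GDD of type $n^k$. A $(w,K)$-PBD (pairwise balanced design) is a pair $(X,\mathcal{A})$ with $|X|=w$ and $\mathcal{A}$ a collection of subsets (blocks) of $X$ such that every pair of distinct points lies in exactly one block and every block has size in $K$. -}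

module Defs where

open import Data.Nat using (ℕ; _≤_; _+_; _*_)
open import Data.Fin using (Fin; _≟_)
open import Data.List using (List; length; filter; map; replicate; _++_; [_])
open import Data.List.Membership.Propositional using (_∈_)
open import Data.List.Relation.Unary.Unique.Propositional using (Unique)
open import Data.List.Relation.Binary.Permutation.Propositional using (_↭_)
open import Data.Fin using (Fin)
open import Data.List using (allFin)
open import Data.Product using (Σ; _×_)
open import Relation.Binary.PropositionalEquality using (_≡_; _≢_)
open import Level using (0ℓ; suc)

ExactlyOne : (b : ℕ) → (Fin b → Set) → Set
ExactlyOne b P = Σ (Fin b) (λ i → P i × ((j : Fin b) → P j → j ≡ i))

-- Exponential notation for a type: t^u as a list of u copies of t.
_^^_ : ℕ → ℕ → List ℕ
t ^^ u = replicate u t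

-- A K-GDD of the given type (a multiset of group sizes, as a list up to permutation).
-- Points are Fin n; groups are the fibres of γ : Fin n → Fin r (r groups);
-- blocks are duplicate-free lists of points, indexed by Fin b.
record GDD (K : ℕ → Set) (type : List ℕ) : Set₁ where
  field
    n : ℕ
    r : ℕ
    γ : Fin n → Fin r
    b : ℕ
    block : Fin b → List (Fin n)
    groupSizes : map (λ g → length (filter (λ x → γ x ≟ g) (allFin n))) (allFin r) ↭ type
    blockSet : (i : Fin b) → Unique (block i)
    blockSize : (i : Fin b) → K (length (block i))
    transverse : (i : Fin b) (x y : Fin n) → x ∈ block i → y ∈ block i → γ x ≡ γ y → x ≡ y
    pairs : (x y : Fin n) → γ x ≢ γ y → ExactlyOne b (λ i → x ∈ block i × y ∈ block i)

record PBD (w : ℕ) (K : ℕ → Set) : Set₁ where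
  field
    b : ℕ
    block : Fin b → List (Fin w)
    blockSet : (i : Fin b) → Unique (block i)
    blockSize : (i : Fin b) → K (length (block i))
    pairs : (x y : Fin w) → x ≢ y → ExactlyOne b (λ i → x ∈ block i × y ∈ block i)

TD : ℕ → ℕ → Set₁
TD k n = GDD (_≡ k) (n ^^ k)

module Submission where

-- Deleting a group of the TD(ℓ+1,m) leaves a TD(ℓ,m) whose blocks fall into m parallel classes of m blocks.
-- Take u layers of its ℓm points: the cells (g, a, w) with level g, point a and layer w. The classes are split
-- into t extra classes, one group class per layer w, and m - t - u plain ones; block i of the group class w,
-- taken in layer w, is a new group of size ℓ, and these mu groups partition the cells. Over each block of
-- each class sits a copy of: for an extra class, the GDD of type u^ℓ v^1 whose v-group is a set of fresh
-- points; for the group class w, the TD(ℓ,u) minus its block that is constantly w; for a plain class, the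
-- whole TD(ℓ,u). Finally each level, together with one point ∞, carries a copy of the (mu+1)-PBD. The t·v
-- fresh points and ∞ form the group of size tv+1. Two cells on different levels lie in exactly one block of
-- the TD(ℓ,m), hence in exactly one block sitting over it; all other pairs are covered by the GDD or a PBD.

open import Defs
open import Data.Nat using (ℕ; zero; suc; _≤_; _<_; _+_; _*_; _∸_; z≤n; s≤s)
import Data.Nat.Properties as ℕ
open import Data.Fin using (Fin; zero; suc; cast; combine; remQuot; punchOut; fromℕ<)
import Data.Fin.Properties as Fin
open import Data.Fin.Permutation using (Permutation; cast-id; transpose)
open import Data.List using (List; []; _∷_; _++_; map; filter; length; allFin; lookup; replicate; tabulate)
import Data.List.Properties as List
open import Data.List.Membership.Propositional using (_∈_)
open import Data.List.Membership.Propositional.Properties using (∈-map⁺; ∈-map⁻; ∈-filter⁺; ∈-filter⁻; ∈-allFin; ∈-lookup)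
open import Data.List.Relation.Unary.Any using (here; there; index; any?)
open import Data.List.Relation.Unary.Any.Properties using (lookup-index)
import Data.List.Relation.Unary.All as All
import Data.List.Relation.Unary.All.Properties as All
open import Data.List.Relation.Unary.Unique.Propositional using (Unique; []; _∷_)
import Data.List.Relation.Unary.Unique.Propositional.Properties as Unique
open import Data.List.Relation.Binary.Permutation.Propositional using (_↭_; ↭⇒↭ₛ)
import Data.List.Relation.Binary.Permutation.Propositional as Perm
import Data.List.Relation.Binary.Permutation.Propositional.Properties as Perm
open import Data.Product using (Σ; ∃; ∃!; _×_; _,_; proj₁; proj₂)
open import Data.Sum using (_⊎_; inj₁; inj₂)
open import Data.Empty using (⊥; ⊥-elim)
open import Data.Unit using (⊤; tt)
open import Function using (_∘_; id; case_of_; _↔_; Inverse; mk↔ₛ′; Injective)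
open import Function.Properties.Inverse using (↔-refl; ↔-sym; ↔-trans; ↔⇒↣)
open import Data.Sum.Function.Propositional using (_⊎-↔_)
open import Data.Product.Function.NonDependent.Propositional using (_×-↔_)
open import Data.Product.Function.Dependent.Propositional using (Σ-↔)
open import Relation.Nullary using (¬_; Dec; yes; no)
open import Relation.Nullary.Decidable using (dec-true)
open import Relation.Binary.PropositionalEquality using (_≡_; _≢_; refl; sym; trans; cong; cong₂; subst; setoid)
open import Axiom.UniquenessOfIdentityProofs using (UIP; module Decidable⇒UIP)
open import Data.List.Relation.Binary.Permutation.Setoid (setoid ℕ) using (onIndices)
open import Data.List.Relation.Binary.Permutation.Setoid.Properties (setoid ℕ) using (onIndices-lookup)

open Inverse using (to; from; strictlyInverseˡ; strictlyInverseʳ)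

private variable
  A B : Set

to-injective : (e : A ↔ B) → Injective _≡_ _≡_ (to e)
to-injective e {x} {y} p =
  trans (sym (strictlyInverseʳ e x)) (trans (cong (from e) p) (strictlyInverseʳ e y))

from-injective : (e : A ↔ B) → Injective _≡_ _≡_ (from e)
from-injective e = to-injective (↔-sym e)

Fin-injective : ∀ {m n} → Fin m ↔ Fin n → m ≡ n
Fin-injective e = Fin.cantor-schröder-bernstein (to-injective e) (from-injective e)

Finite : Set → Set
Finite A = Σ ℕ λ n → A ↔ Fin n

⊎-finite : Finite A → Finite B → Finite (A ⊎ B)
⊎-finite (m , e) (n , f) = m + n , ↔-trans (e ⊎-↔ f) (↔-sym Fin.+↔⊎)

×-finite : Finite A → Finite B → Finite (A × B)
×-finite (m , e) (n , f) = m * n , ↔-trans (e ×-↔ f) (↔-sym Fin.*↔×)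

↔-finite : A ↔ B → Finite B → Finite A
↔-finite e (n , f) = n , ↔-trans e f

Fin-finite : ∀ {n} → Finite (Fin n)
Fin-finite {n} = n , ↔-refl

⊤-finite : Finite ⊤
⊤-finite = 1 , ↔-sym Fin.1↔⊤

↔Fin⇒UIP : ∀ {n} → A ↔ Fin n → UIP A
↔Fin⇒UIP e = Decidable⇒UIP.≡-irrelevant (Fin.inj⇒≟ (↔⇒↣ e))

lookup-injective : {xs : List A} → Unique xs → ∀ i j → lookup xs i ≡ lookup xs j → i ≡ j
lookup-injective (_ ∷ _) zero zero _ = refl
lookup-injective (x∉ ∷ _) zero (suc j) p = ⊥-elim (All.lookup x∉ (∈-lookup j) p)
lookup-injective (x∉ ∷ _) (suc i) zero p = ⊥-elim (All.lookup x∉ (∈-lookup i) (sym p))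
lookup-injective (_ ∷ u) (suc i) (suc j) p = cong suc (lookup-injective u i j p)

map-unique : (f : A → B) {xs : List A} → (∀ {x y} → x ∈ xs → y ∈ xs → f x ≡ f y → x ≡ y) →
  Unique xs → Unique (map f xs)
map-unique f {[]} _ [] = []
map-unique f {x ∷ xs} f-injective (x∉ ∷ u) =
  All.map⁺ (All.tabulate λ {y} y∈ p → All.lookup x∉ y∈ (f-injective (here refl) (there y∈) p)) ∷
  map-unique f (λ x∈ y∈ → f-injective (there x∈) (there y∈)) u

unique-full : ∀ {n} {xs : List (Fin n)} → Unique xs → length xs ≡ n → ∀ i → i ∈ xs
unique-full {suc n} {xs} u len i with any? (i Fin.≟_) xs
... | yes i∈ = i∈
... | no i∉ = ⊥-elim (ℕ.<-irrefl refl (subst (_≤ n) len (Fin.injective⇒≤ punchOut-injective)))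
  where
  i≢ : ∀ j → i ≢ lookup xs j
  i≢ j p = i∉ (subst (_∈ xs) (sym p) (∈-lookup j))
  punchOut-injective : Injective _≡_ _≡_ (λ j → punchOut (i≢ j))
  punchOut-injective p = lookup-injective u _ _ (Fin.punchOut-injective (i≢ _) (i≢ _) p)

∈-map-to : (e : A ↔ B) {y : B} {xs : List A} → from e y ∈ xs → y ∈ map (to e) xs
∈-map-to e {y} p = subst (_∈ _) (strictlyInverseˡ e y) (∈-map⁺ (to e) p)

∈-map-from : (e : A ↔ B) {y : B} {xs : List A} → y ∈ map (to e) xs → from e y ∈ xs
∈-map-from e p with ∈-map⁻ (to e) p
... | x , x∈ , refl = subst (_∈ _) (sym (strictlyInverseʳ e x)) x∈

replicate-lookup : ∀ n (x : A) i → lookup (replicate n x) i ≡ x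
replicate-lookup (suc n) x zero = refl
replicate-lookup (suc n) x (suc i) = replicate-lookup n x i

lookup-map-tabulate : ∀ {n} (f : A → B) (h : Fin n → A) .(e : n ≡ length (map f (tabulate h))) i →
  lookup (map f (tabulate h)) (cast e i) ≡ f (h i)
lookup-map-tabulate f h e zero = refl
lookup-map-tabulate f h e (suc i) = lookup-map-tabulate f (h ∘ suc) (ℕ.suc-injective e) i

tabulate-const : ∀ n (x : A) → tabulate {n = n} (λ _ → x) ≡ replicate n x
tabulate-const zero x = refl
tabulate-const (suc n) x = cong (x ∷_) (tabulate-const n x)

∃!-unique : {P : A → Set} → ∃! _≡_ P → ∀ {x y} → P x → P y → x ≡ y
∃!-unique (_ , _ , unique) p q = trans (sym (unique p)) (unique q)

∃!-cong : {P Q : A → Set} → (∀ {a} → P a → Q a) → (∀ {a} → Q a → P a) → ∃! _≡_ P → ∃! _≡_ Q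
∃!-cong P⇒Q Q⇒P (a , p , unique) = a , P⇒Q p , unique ∘ Q⇒P

∃!-image : {Q : B → Set} (f : A → B) → (∀ {y} → Q y → ∃ λ x → f x ≡ y) → ∃! _≡_ (Q ∘ f) → ∃! _≡_ Q
∃!-image f onto (x , q , unique) = f x , q , λ qy → case onto qy of λ { (x′ , refl) → cong f (unique qy) }

∃!-suc : ∀ {n} {Q : Fin (suc n) → Set} → ¬ Q zero → ∃! _≡_ Q → ∃! _≡_ (Q ∘ suc)
∃!-suc ¬q₀ (zero , q , _) = ⊥-elim (¬q₀ q)
∃!-suc ¬q₀ (suc r , q , unique) = r , q , λ q′ → Fin.suc-injective (unique q′)

∃!-swap : {P Q : A → Set} → ∃! _≡_ (λ a → P a × Q a) → ∃! _≡_ (λ a → Q a × P a)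
∃!-swap = ∃!-cong (λ (p , q) → q , p) (λ (q , p) → p , q)

exactlyOne⇒∃! : ∀ {b} {P : Fin b → Set} → ExactlyOne b P → ∃! _≡_ P
exactlyOne⇒∃! (i , p , unique) = i , p , λ q → sym (unique _ q)

∃!⇒exactlyOne : ∀ {b} {P : A → Set} (e : A ↔ Fin b) → ∃! _≡_ P → ExactlyOne b (P ∘ from e)
∃!⇒exactlyOne {P = P} e (a , p , unique) =
  to e a , subst P (sym (strictlyInverseʳ e a)) p ,
  λ j q → trans (sym (strictlyInverseˡ e j)) (cong (to e) (sym (unique q)))

Fibre : (A → B) → B → Set
Fibre {A} f y = Σ A λ x → f x ≡ y

fibre-≡ : UIP B → {f : A → B} {y : B} {p q : Fibre f y} → proj₁ p ≡ proj₁ q → p ≡ q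
fibre-≡ uip {p = x , e} {.x , e′} refl = cong (x ,_) (uip e e′)

Σ-fibres : (f : A → B) → A ↔ Σ B (Fibre f)
Σ-fibres f = mk↔ₛ′ (λ x → f x , x , refl) (λ (_ , x , _) → x) (λ { (_ , x , refl) → refl }) (λ _ → refl)

fibreSize : ∀ {n r} → (Fin n → Fin r) → Fin r → ℕ
fibreSize {n} f g = length (filter (λ x → f x Fin.≟ g) (allFin n))

fibreSize↔ : ∀ {n r} (f : Fin n → Fin r) g → Fin (fibreSize f g) ↔ Fibre f g
fibreSize↔ {n} f g = mk↔ₛ′ point position point-position position-point
  where
  P? : ∀ x → Dec (f x ≡ g)
  P? x = f x Fin.≟ g
  xs : List (Fin n)
  xs = filter P? (allFin n)
  point : Fin (length xs) → Fibre f g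
  point i = lookup xs i , proj₂ (∈-filter⁻ P? {xs = allFin n} (∈-lookup i))
  position : Fibre f g → Fin (length xs)
  position (x , p) = index (∈-filter⁺ P? (∈-allFin x) p)
  point-position : ∀ p → point (position p) ≡ p
  point-position (x , p) =
    fibre-≡ (Decidable⇒UIP.≡-irrelevant Fin._≟_) (sym (lookup-index (∈-filter⁺ P? (∈-allFin x) p)))
  position-point : ∀ i → position (point i) ≡ i
  position-point i =
    lookup-injective (Unique.filter⁺ P? (Unique.allFin⁺ n)) _ _ (cong proj₁ (point-position (point i)))

fibre-↔ : ∀ {A′ B′ : Set} → UIP B → UIP B′ → (e : A ↔ A′) (e′ : B ↔ B′) (f : A → B) (y : B′) →
  Fibre (to e′ ∘ f ∘ from e) y ↔ Fibre f (from e′ y)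
fibre-↔ uip uip′ e e′ f y = mk↔ₛ′
  (λ (x , p) → from e x , trans (sym (strictlyInverseʳ e′ _)) (cong (from e′) p))
  (λ (x , q) → to e x ,
    trans (cong (to e′ ∘ f) (strictlyInverseʳ e x)) (trans (cong (to e′) q) (strictlyInverseˡ e′ y)))
  (λ (x , _) → fibre-≡ uip (strictlyInverseʳ e x))
  (λ (x , _) → fibre-≡ uip′ (strictlyInverseˡ e x))

-- Designs on arbitrary point, group and block sets

record Design (K : ℕ → Set) {X Γ : Set} (group : X → Γ) : Set₁ where
  field
    Block : Set
    points : Block → List X
    points-unique : ∀ B → Unique (points B)
    points-size : ∀ B → K (length (points B))
    transverse : ∀ B {x y} → x ∈ points B → y ∈ points B → group x ≡ group y → x ≡ y
    pairs : ∀ {x y} → group x ≢ group y → ∃! _≡_ λ B → x ∈ points B × y ∈ points B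

transport : ∀ {K X Y Γ Δ} {γ : X → Γ} {δ : Y → Δ} (e : X ↔ Y) (κ : Γ → Δ) → Injective _≡_ _≡_ κ →
  (∀ x → δ (to e x) ≡ κ (γ x)) → Design K γ → Design K δ
transport {K = K} {γ = γ} {δ} e κ κ-injective compat D = record
  { Block = Block
  ; points = map (to e) ∘ points
  ; points-unique = λ B → Unique.map⁺ (to-injective e) (points-unique B)
  ; points-size = λ B → subst K (sym (List.length-map (to e) (points B))) (points-size B)
  ; transverse = λ B x∈ y∈ p →
      from-injective e (transverse B (∈-map-from e x∈) (∈-map-from e y∈) (κ-injective (group-from-≡ p)))
  ; pairs = λ p → ∃!-cong (λ (x∈ , y∈) → ∈-map-to e x∈ , ∈-map-to e y∈)
                          (λ (x∈ , y∈) → ∈-map-from e x∈ , ∈-map-from e y∈)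
                          (pairs (p ∘ group-to-≡))
  }
  where
  open Design D
  δ-from : ∀ y → δ y ≡ κ (γ (from e y))
  δ-from y = trans (cong δ (sym (strictlyInverseˡ e y))) (compat (from e y))
  group-from-≡ : ∀ {y y′} → δ y ≡ δ y′ → κ (γ (from e y)) ≡ κ (γ (from e y′))
  group-from-≡ {y} {y′} p = trans (sym (δ-from y)) (trans p (δ-from y′))
  group-to-≡ : ∀ {y y′} → γ (from e y) ≡ γ (from e y′) → δ y ≡ δ y′
  group-to-≡ {y} {y′} p = trans (δ-from y) (trans (cong κ p) (sym (δ-from y′)))

gddDesign : ∀ {K τ} (D : GDD K τ) → Design K (GDD.γ D)
gddDesign D = record
  { Block = Fin b ; points = block ; points-unique = blockSet ; points-size = blockSize
  ; transverse = λ B → transverse B _ _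
  ; pairs = λ p → exactlyOne⇒∃! (pairs _ _ p) }
  where open GDD D

pbdDesign : ∀ {K w} → PBD w K → Design K (id {A = Fin w})
pbdDesign P = record
  { Block = Fin b ; points = block ; points-unique = blockSet ; points-size = blockSize
  ; transverse = λ _ _ _ p → p
  ; pairs = λ p → exactlyOne⇒∃! (pairs _ _ p) }
  where open PBD P

toGDD : ∀ {K τ r X Γ} {γ : X → Γ} (D : Design K γ) → Finite X → Finite (Design.Block D) →
  (e : Γ ↔ Fin r) (size : Γ → ℕ) → (∀ g → Fibre γ g ↔ Fin (size g)) →
  tabulate (size ∘ from e) ↭ τ → GDD K τ
toGDD {K} {τ} {r} {γ = γ} D (n , eX) (b , eB) e size fibre↔ sizes = record
  { n = n ; r = r ; γ = δ ; b = b
  ; block = points ∘ from eB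
  ; groupSizes =
      subst (_↭ τ) (sym (trans (List.map-tabulate id (fibreSize δ)) (List.tabulate-cong fibreSize-δ))) sizes
  ; blockSet = points-unique ∘ from eB
  ; blockSize = points-size ∘ from eB
  ; transverse = λ i x y → transverse (from eB i)
  ; pairs = λ x y p → ∃!⇒exactlyOne eB (pairs p) }
  where
  δ : Fin n → Fin r
  δ = to e ∘ γ ∘ from eX
  open Design (transport {δ = δ} eX (to e) (to-injective e) (cong (to e ∘ γ) ∘ strictlyInverseʳ eX) D)
  fibreSize-δ : ∀ g → fibreSize δ g ≡ size (from e g)
  fibreSize-δ g = Fin-injective (↔-trans (fibreSize↔ δ g)
    (↔-trans (fibre-↔ (↔Fin⇒UIP e) (Decidable⇒UIP.≡-irrelevant Fin._≟_) eX e γ g) (fibre↔ (from e g))))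

Labelling : ∀ {n r} → (Fin n → Fin r) → List ℕ → Set
Labelling {r = r} γ τ = Σ (Fin r ↔ Fin (length τ)) λ β → ∀ g → fibreSize γ g ≡ lookup τ (to β g)

groupLabels : ∀ {n r τ} (γ : Fin n → Fin r) → map (fibreSize γ) (allFin r) ↭ τ → Labelling γ τ
groupLabels {r = r} γ sizes =
  ↔-trans (cast-id e) (onIndices (↭⇒↭ₛ sizes)) ,
  λ g → trans (sym (lookup-map-tabulate (fibreSize γ) id e g)) (onIndices-lookup (↭⇒↭ₛ sizes) (cast e g))
  where
  e : r ≡ length (map (fibreSize γ) (allFin r))
  e = sym (trans (List.length-map (fibreSize γ) (allFin r)) (List.length-tabulate id))

tdDesign : ∀ {k m} (T : TD k m) → Design (_≡ k) (proj₁ {A = Fin k} {B = λ _ → Fin m})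
tdDesign {k} {m} T = transport {δ = proj₁} coordinates (to relabel) (to-injective relabel) (λ _ → refl) (gddDesign T)
  where
  open GDD T
  labels : Labelling γ (m ^^ k)
  labels = groupLabels γ groupSizes
  relabel : Fin r ↔ Fin k
  relabel = ↔-trans (proj₁ labels) (cast-id (List.length-replicate k))
  size≡m : ∀ g → fibreSize γ g ≡ m
  size≡m g = trans (proj₂ labels g) (replicate-lookup k m _)
  coordinates : Fin n ↔ (Fin k × Fin m)
  coordinates = ↔-trans (Σ-fibres γ)
    (Σ-↔ {A = Fibre γ} {B = λ _ → Fin m} relabel λ {g} → ↔-trans (↔-sym (fibreSize↔ γ g)) (cast-id (size≡m g)))

suc↔ : ∀ {n} → Fin (suc n) ↔ (⊤ ⊎ Fin n)
suc↔ = mk↔ₛ′ (λ { zero → inj₁ tt ; (suc i) → inj₂ i }) (λ { (inj₁ _) → zero ; (inj₂ i) → suc i })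
  (λ { (inj₁ _) → refl ; (inj₂ _) → refl }) (λ { zero → refl ; (suc _) → refl })

-- A GDD of type u^ℓ v^1 on Fin v ⊎ (Fin ℓ × Fin u); inj₁ tt is the group of size v.
uvGroup : ∀ {ℓ u v} → Fin v ⊎ (Fin ℓ × Fin u) → ⊤ ⊎ Fin ℓ
uvGroup (inj₁ _) = inj₁ tt
uvGroup (inj₂ (g , _)) = inj₂ g

uvDesign : ∀ {K ℓ u v} → GDD K ((u ^^ ℓ) ++ (v ^^ 1)) → Design K (uvGroup {ℓ} {u} {v})
uvDesign {K} {ℓ} {u} {v} D =
  transport coordinates (to relabel) (to-injective relabel) (λ _ → uvGroup-Σ-size _) (gddDesign D)
  where
  open GDD D
  labels : Labelling γ (v ∷ (u ^^ ℓ))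
  labels = groupLabels γ (Perm.↭-trans groupSizes (Perm.++-comm (u ^^ ℓ) (v ^^ 1)))
  positions : Fin (length (v ∷ (u ^^ ℓ))) ↔ (⊤ ⊎ Fin ℓ)
  positions = ↔-trans suc↔ (↔-refl ⊎-↔ cast-id (List.length-replicate ℓ))
  relabel : Fin r ↔ (⊤ ⊎ Fin ℓ)
  relabel = ↔-trans (proj₁ labels) positions
  size : ⊤ ⊎ Fin ℓ → ℕ
  size (inj₁ _) = v
  size (inj₂ _) = u
  size-lookup : ∀ i → lookup (v ∷ (u ^^ ℓ)) i ≡ size (to positions i)
  size-lookup zero = refl
  size-lookup (suc i) = replicate-lookup ℓ u i
  Σ-size : Σ (⊤ ⊎ Fin ℓ) (Fin ∘ size) ↔ (Fin v ⊎ (Fin ℓ × Fin u))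
  Σ-size = mk↔ₛ′ (λ { (inj₁ _ , c) → inj₁ c ; (inj₂ g , w) → inj₂ (g , w) })
                 (λ { (inj₁ c) → inj₁ tt , c ; (inj₂ (g , w)) → inj₂ g , w })
                 (λ { (inj₁ _) → refl ; (inj₂ _) → refl }) (λ { (inj₁ _ , _) → refl ; (inj₂ _ , _) → refl })
  uvGroup-Σ-size : ∀ p → uvGroup (to Σ-size p) ≡ proj₁ p
  uvGroup-Σ-size (inj₁ _ , _) = refl
  uvGroup-Σ-size (inj₂ _ , _) = refl
  coordinates : Fin n ↔ (Fin v ⊎ (Fin ℓ × Fin u))
  coordinates = ↔-trans (Σ-fibres γ) (↔-trans
    (Σ-↔ {A = Fibre γ} {B = Fin ∘ size} relabel λ {g} →
      ↔-trans (↔-sym (fibreSize↔ γ g)) (cast-id (trans (proj₂ labels g) (size-lookup (to (proj₁ labels) g)))))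
    Σ-size)

-- Orthogonal arrays and resolved transversal designs

record OrthogonalArray (k n : ℕ) (Row : Set) : Set where
  field
    entry : Row → Fin k → Fin n
    pairs : ∀ {j j′} → j ≢ j′ → ∀ a a′ → ∃! _≡_ λ r → entry r j ≡ a × entry r j′ ≡ a′

module _ {k n : ℕ} (D : Design (_≡ k) (proj₁ {A = Fin k} {B = λ _ → Fin n})) where
  open Design D

  private
    -- The k points of a block lie in distinct groups, so the block meets all k groups.
    column : ∀ B j → Σ (Fin n) λ a → (j , a) ∈ points B
    column B j with ∈-map⁻ proj₁ (unique-full
        (map-unique proj₁ (transverse B) (points-unique B))
        (trans (List.length-map proj₁ (points B)) (points-size B)) j)
    ... | (_ , a) , a∈ , refl = a , a∈

    column-unique : ∀ {B j a} → (j , a) ∈ points B → proj₁ (column B j) ≡ a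
    column-unique {B} {j} a∈ = cong proj₂ (transverse B (proj₂ (column B j)) a∈ refl)

  designOA : OrthogonalArray k n Block
  designOA = record
    { entry = λ B j → proj₁ (column B j)
    ; pairs = λ {j} {j′} j≢j′ a a′ → ∃!-cong
        (λ (a∈ , a′∈) → column-unique a∈ , column-unique a′∈)
        (λ { {B} (refl , refl) → proj₂ (column B j) , proj₂ (column B j′) })
        (pairs j≢j′) }

sucRows : ∀ {k n b} → 2 ≤ k → 0 < n → OrthogonalArray k n (Fin b) → ∃ λ b′ → OrthogonalArray k n (Fin (suc b′))
sucRows {b = suc b′} _ _ O = b′ , O
sucRows {suc (suc k)} {suc n} {zero} (s≤s (s≤s z≤n)) _ O with OrthogonalArray.pairs O {zero} {suc zero} (λ ()) zero zero
... | () , _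

module _ {k n : ℕ} {Row : Set} (O : OrthogonalArray k n Row) where
  open OrthogonalArray O

  permuteSymbols : (Fin k → Permutation n n) → OrthogonalArray k n Row
  permuteSymbols π = record
    { entry = λ r j → to (π j) (entry r j)
    ; pairs = λ j≢j′ a a′ → ∃!-cong
        (λ {r} (p , p′) → to-from (π _) p , to-from (π _) p′)
        (λ {r} (p , p′) → from-to (π _) p , from-to (π _) p′)
        (pairs j≢j′ (from (π _) a) (from (π _) a′)) }
    where
    to-from : ∀ (e : Fin n ↔ Fin n) {x y} → x ≡ from e y → to e x ≡ y
    to-from e {y = y} refl = strictlyInverseˡ e y
    from-to : ∀ (e : Fin n ↔ Fin n) {x y} → to e x ≡ y → x ≡ from e y
    from-to e {x} refl = sym (strictlyInverseʳ e x)

  normalise : Row → Fin n → OrthogonalArray k n Row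
  normalise r₀ w = permuteSymbols λ j → transpose (entry r₀ j) w

  normalise-constant : ∀ r₀ w j → OrthogonalArray.entry (normalise r₀ w) r₀ j ≡ w
  normalise-constant r₀ w j rewrite dec-true (entry r₀ j Fin.≟ entry r₀ j) refl = refl

-- point c i g is the point in group g of the block i of the parallel class c.
record ResolvedTD (C : Set) (ℓ m : ℕ) : Set where
  field
    point : C → Fin m → Fin ℓ → Fin m
    blockAt : C → Fin ℓ → Fin m → Fin m
    point-blockAt : ∀ c g a → point c (blockAt c g a) g ≡ a
    blockAt-unique : ∀ {c g a} i → point c i g ≡ a → i ≡ blockAt c g a
    joining : ∀ {g g′} → g ≢ g′ → ∀ a a′ → ∃! _≡_ λ ((c , i) : C × Fin m) →
      point c i g ≡ a × point c i g′ ≡ a′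

  joining-unique : ∀ {g g′} → g ≢ g′ → ∀ {a a′ c c′ i i′} → point c i g ≡ a × point c i g′ ≡ a′ →
    point c′ i′ g ≡ a × point c′ i′ g′ ≡ a′ → (c , i) ≡ (c′ , i′)
  joining-unique g≢g′ = ∃!-unique (joining g≢g′ _ _)

-- Deleting the group 0 of a TD(ℓ+1,m): the blocks through a deleted point form a parallel class,
-- in which a block is named by its point in the group suc z.
resolve : ∀ {C ℓ m Row} → OrthogonalArray (suc ℓ) m Row → C ↔ Fin m → Fin ℓ → ResolvedTD C ℓ m
resolve {C} {ℓ} {m} {Row} O e z = record
  { point = point
  ; blockAt = blockAt
  ; point-blockAt = point-blockAt
  ; blockAt-unique = blockAt-unique
  ; joining = joining }
  where
  open OrthogonalArray O
  row : ∀ {j j′} → j ≢ j′ → Fin m → Fin m → Row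
  row j≢j′ a a′ = proj₁ (pairs j≢j′ a a′)
  row-entries : ∀ {j j′} (j≢j′ : j ≢ j′) a a′ → entry (row j≢j′ a a′) j ≡ a × entry (row j≢j′ a a′) j′ ≡ a′
  row-entries j≢j′ a a′ = proj₁ (proj₂ (pairs j≢j′ a a′))
  row-unique : ∀ {j j′} (j≢j′ : j ≢ j′) {a a′ r} → entry r j ≡ a → entry r j′ ≡ a′ → row j≢j′ a a′ ≡ r
  row-unique j≢j′ p p′ = proj₂ (proj₂ (pairs j≢j′ _ _)) (p , p′)
  0≢suc : ∀ {g : Fin ℓ} → zero ≢ suc g
  0≢suc ()
  block : C → Fin m → Row
  block c i = row (0≢suc {z}) (to e c) i
  point : C → Fin m → Fin ℓ → Fin m
  point c i g = entry (block c i) (suc g)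
  blockAt : C → Fin ℓ → Fin m → Fin m
  blockAt c g a = entry (row (0≢suc {g}) (to e c) a) (suc z)
  point-blockAt : ∀ c g a → point c (blockAt c g a) g ≡ a
  point-blockAt c g a =
    trans (cong (λ r → entry r (suc g)) (row-unique 0≢suc (proj₁ (row-entries 0≢suc (to e c) a)) refl))
          (proj₂ (row-entries 0≢suc (to e c) a))
  blockAt-unique : ∀ {c g a} i → point c i g ≡ a → i ≡ blockAt c g a
  blockAt-unique {c} {g} i p =
    trans (sym (proj₂ (row-entries 0≢suc (to e c) i)))
          (cong (λ r → entry r (suc z)) (sym (row-unique 0≢suc (proj₁ (row-entries 0≢suc (to e c) i)) p)))
  joining : ∀ {g g′} → g ≢ g′ → ∀ a a′ → ∃! _≡_ λ ((c , i) : C × Fin m) →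
      point c i g ≡ a × point c i g′ ≡ a′
  joining {g} {g′} g≢g′ a a′ =
    (from e (entry r zero) , entry r (suc z)) ,
    (trans (cong (λ r′ → entry r′ (suc _)) block-r) (proj₁ (row-entries suc≢ a a′)) ,
     trans (cong (λ r′ → entry r′ (suc _)) block-r) (proj₂ (row-entries suc≢ a a′))) ,
    λ {(c , i)} (p , p′) → let r≡ = row-unique suc≢ p p′ in
      cong₂ _,_ (trans (cong (λ r′ → from e (entry r′ zero)) r≡)
                       (trans (cong (from e) (proj₁ (row-entries 0≢suc (to e c) i))) (strictlyInverseʳ e c)))
                (trans (cong (λ r′ → entry r′ (suc z)) r≡) (proj₂ (row-entries 0≢suc (to e c) i)))
    where
    suc≢ : suc g ≢ suc g′
    suc≢ = g≢g′ ∘ Fin.suc-injective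
    r : Row
    r = row suc≢ a a′
    block-r : block (from e (entry r zero)) (entry r (suc z)) ≡ r
    block-r = row-unique 0≢suc (sym (strictlyInverseˡ e _)) refl

-- The construction

data Class (t u z : ℕ) : Set where
  extraClass : Fin t → Class t u z
  groupClass : Fin u → Class t u z
  plainClass : Fin z → Class t u z

classes : ∀ {t u z} → Class t u z ↔ Fin (t + (u + z))
classes {t} {u} {z} = ↔-trans split (↔-trans (↔-refl ⊎-↔ ↔-sym (Fin.+↔⊎ {u} {z})) (↔-sym (Fin.+↔⊎ {t})))
  where
  split : Class t u z ↔ (Fin t ⊎ (Fin u ⊎ Fin z))
  split = mk↔ₛ′
    (λ { (extraClass s) → inj₁ s ; (groupClass w) → inj₂ (inj₁ w) ; (plainClass x) → inj₂ (inj₂ x) })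
    (λ { (inj₁ s) → extraClass s ; (inj₂ (inj₁ w)) → groupClass w ; (inj₂ (inj₂ x)) → plainClass x })
    (λ { (inj₁ _) → refl ; (inj₂ (inj₁ _)) → refl ; (inj₂ (inj₂ _)) → refl })
    (λ { (extraClass _) → refl ; (groupClass _) → refl ; (plainClass _) → refl })

module Construction {K : ℕ → Set} {ℓ m u v t z b : ℕ} (Kℓ : K ℓ)
  (R : ResolvedTD (Class t u z) ℓ m)
  (S : OrthogonalArray ℓ u (Fin (suc b)))
  (G : Design K (uvGroup {ℓ} {u} {v}))
  (P : Design K (id {A = (Fin m × Fin u) ⊎ ⊤}))
  where

  open ResolvedTD R
  module G = Design G
  module P = Design P
  module S = OrthogonalArray S

  Sʷ : Fin u → OrthogonalArray ℓ u (Fin (suc b))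
  Sʷ w = normalise S zero w

  data Point : Set where
    cell : Fin ℓ → Fin m → Fin u → Point
    extra : Fin t → Fin v → Point
    ∞ : Point

  data Group : Set where
    new : Fin m → Fin u → Group
    old : Group

  group : Point → Group
  group (cell g a w) = new (blockAt (groupClass w) g a) w
  group (extra _ _) = old
  group ∞ = old

  LineBlock : Class t u z → Set
  LineBlock (extraClass _) = G.Block
  LineBlock (groupClass _) = Fin b
  LineBlock (plainClass _) = Fin (suc b)

  data Block : Set where
    onLine : (c : Class t u z) → Fin m → LineBlock c → Block
    vertical : Fin ℓ → P.Block → Block

  cells : Class t u z → Fin m → (Fin ℓ → Fin u) → List Point
  cells c i h = map (λ g → cell g (point c i g) (h g)) (allFin ℓ)

  inflate : Fin t → Fin m → Fin v ⊎ (Fin ℓ × Fin u) → Point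
  inflate s i (inj₁ e) = extra s e
  inflate s i (inj₂ (g , w)) = cell g (point (extraClass s) i g) w

  onLevel : Fin ℓ → (Fin m × Fin u) ⊎ ⊤ → Point
  onLevel g (inj₁ (a , w)) = cell g a w
  onLevel g (inj₂ _) = ∞

  points : Block → List Point
  points (onLine (extraClass s) i B) = map (inflate s i) (G.points B)
  points (onLine (groupClass w) i r) = cells (groupClass w) i (OrthogonalArray.entry (Sʷ w) (suc r))
  points (onLine (plainClass x) i r) = cells (plainClass x) i (S.entry r)
  points (vertical g B) = map (onLevel g) (P.points B)

  ∈-cells : ∀ {c i h x} → x ∈ cells c i h → ∃ λ g → x ≡ cell g (point c i g) (h g)
  ∈-cells x∈ with ∈-map⁻ _ x∈
  ... | g , _ , p = g , p

  cell-∈-cells⁺ : ∀ {c i h g a w} → point c i g ≡ a → h g ≡ w → cell g a w ∈ cells c i h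
  cell-∈-cells⁺ refl refl = ∈-map⁺ _ (∈-allFin _)

  cell-∈-cells⁻ : ∀ {c i h g a w} → cell g a w ∈ cells c i h → point c i g ≡ a × h g ≡ w
  cell-∈-cells⁻ x∈ with ∈-cells x∈
  ... | _ , refl = refl , refl

  cell-∈-inflate⁺ : ∀ {s i g a w xs} → point (extraClass s) i g ≡ a → inj₂ (g , w) ∈ xs →
    cell g a w ∈ map (inflate s i) xs
  cell-∈-inflate⁺ refl p∈ = ∈-map⁺ _ p∈

  cell-∈-inflate⁻ : ∀ {s i g a w xs} → cell g a w ∈ map (inflate s i) xs →
    point (extraClass s) i g ≡ a × inj₂ (g , w) ∈ xs
  cell-∈-inflate⁻ x∈ with ∈-map⁻ _ x∈
  ... | inj₂ _ , p∈ , refl = refl , p∈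

  extra-∈-inflate⁻ : ∀ {s s′ i e xs} → extra s′ e ∈ map (inflate s i) xs → s′ ≡ s × inj₁ e ∈ xs
  extra-∈-inflate⁻ x∈ with ∈-map⁻ _ x∈
  ... | inj₁ _ , p∈ , refl = refl , p∈

  cell-∈-onLevel⁻ : ∀ {g′ g a w xs} → cell g a w ∈ map (onLevel g′) xs → g ≡ g′ × inj₁ (a , w) ∈ xs
  cell-∈-onLevel⁻ x∈ with ∈-map⁻ _ x∈
  ... | inj₁ _ , p∈ , refl = refl , p∈

  ∞-∈-onLevel⁻ : ∀ {g xs} → ∞ ∈ map (onLevel g) xs → inj₂ tt ∈ xs
  ∞-∈-onLevel⁻ x∈ with ∈-map⁻ _ x∈
  ... | inj₂ _ , p∈ , refl = p∈

  extra-∉-onLevel : ∀ {g s e xs} → extra s e ∈ map (onLevel g) xs → ⊥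
  extra-∉-onLevel x∈ with ∈-map⁻ _ x∈
  ... | inj₁ _ , _ , ()
  ... | inj₂ _ , _ , ()

  cell-∈-onLine : ∀ c {i β g a w} → cell g a w ∈ points (onLine c i β) → point c i g ≡ a
  cell-∈-onLine (extraClass _) x∈ = proj₁ (cell-∈-inflate⁻ x∈)
  cell-∈-onLine (groupClass _) x∈ = proj₁ (cell-∈-cells⁻ x∈)
  cell-∈-onLine (plainClass _) x∈ = proj₁ (cell-∈-cells⁻ x∈)

  extra-∈-onLine : ∀ c {i β s e} → extra s e ∈ points (onLine c i β) → c ≡ extraClass s
  extra-∈-onLine (extraClass _) x∈ = cong extraClass (sym (proj₁ (extra-∈-inflate⁻ x∈)))
  extra-∈-onLine (groupClass _) x∈ with ∈-cells x∈
  ... | _ , ()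
  extra-∈-onLine (plainClass _) x∈ with ∈-cells x∈
  ... | _ , ()

  ∞-∉-onLine : ∀ c {i β} → ∞ ∈ points (onLine c i β) → ⊥
  ∞-∉-onLine (extraClass _) x∈ with ∈-map⁻ _ x∈
  ... | inj₁ _ , _ , ()
  ... | inj₂ _ , _ , ()
  ∞-∉-onLine (groupClass _) x∈ with ∈-cells x∈
  ... | _ , ()
  ∞-∉-onLine (plainClass _) x∈ with ∈-cells x∈
  ... | _ , ()

  onLine-sameLevel : ∀ c {i β g a a′ w w′} → cell g a w ∈ points (onLine c i β) →
    cell g a′ w′ ∈ points (onLine c i β) →
    cell g a w ≡ cell g a′ w′
  onLine-sameLevel (extraClass _) {β = B} x∈ y∈ with cell-∈-inflate⁻ x∈ | cell-∈-inflate⁻ y∈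
  ... | refl , p∈ | refl , q∈ with G.transverse B p∈ q∈ refl
  ... | refl = refl
  onLine-sameLevel (groupClass _) x∈ y∈ with cell-∈-cells⁻ x∈ | cell-∈-cells⁻ y∈
  ... | refl , refl | refl , refl = refl
  onLine-sameLevel (plainClass _) x∈ y∈ with cell-∈-cells⁻ x∈ | cell-∈-cells⁻ y∈
  ... | refl , refl | refl , refl = refl

  onLine-extra : ∀ c {i β s s′ e e′} → extra s e ∈ points (onLine c i β) → extra s′ e′ ∈ points (onLine c i β) →
    extra s e ≡ extra s′ e′
  onLine-extra (extraClass _) {β = B} x∈ y∈ with extra-∈-inflate⁻ x∈ | extra-∈-inflate⁻ y∈
  ... | refl , p∈ | refl , q∈ with G.transverse B p∈ q∈ refl
  ... | refl = refl
  onLine-extra (groupClass _) x∈ y∈ with ∈-cells x∈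
  ... | _ , ()
  onLine-extra (plainClass _) x∈ y∈ with ∈-cells x∈
  ... | _ , ()

  new-injective : ∀ {i i′ w w′} → new i w ≡ new i′ w′ → i ≡ i′ × w ≡ w′
  new-injective refl = refl , refl

  group-onLine : ∀ {w i g a} → point (groupClass w) i g ≡ a → group (cell g a w) ≡ new i w
  group-onLine {i = i} p = cong (λ j → new j _) (sym (blockAt-unique i p))

  group-sameLevel-injective : ∀ {g a a′ w w′} → group (cell g a w) ≡ group (cell g a′ w′) → cell g a w ≡ cell g a′ w′
  group-sameLevel-injective {g} {a} {a′} p with new-injective p
  ... | i≡ , refl = cong (λ a → cell g a _)
    (trans (sym (point-blockAt _ g a)) (trans (cong (λ i → point _ i g) i≡) (point-blockAt _ g a′)))

  constantRow-unique : ∀ {w g g′} (r : Fin b) → g ≢ g′ →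
    OrthogonalArray.entry (Sʷ w) (suc r) g ≡ w → OrthogonalArray.entry (Sʷ w) (suc r) g′ ≡ w → ⊥
  constantRow-unique {w} r g≢g′ p p′ = Fin.0≢1+n (∃!-unique (OrthogonalArray.pairs (Sʷ w) g≢g′ w w)
    (normalise-constant S zero w _ , normalise-constant S zero w _) (p , p′))

  -- Two cells of one new group on distinct levels span a block of a group class only in its removed row.
  onLine-newGroup : ∀ c {i β g g′ a a′ w w′} → g ≢ g′ → group (cell g a w) ≡ group (cell g′ a′ w′) →
    cell g a w ∈ points (onLine c i β) → cell g′ a′ w′ ∈ points (onLine c i β) → ⊥
  onLine-newGroup c {g = g} {g′} {a} {a′} g≢g′ p x∈ y∈ with new-injective p
  ... | i≡ , refl with joining-unique g≢g′ (cell-∈-onLine c x∈ , cell-∈-onLine c y∈)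
                         (point-blockAt _ g a , trans (cong (λ i → point _ i g′) i≡) (point-blockAt _ g′ a′))
  ... | refl = constantRow-unique _ g≢g′ (proj₂ (cell-∈-cells⁻ x∈)) (proj₂ (cell-∈-cells⁻ y∈))

  transverse : ∀ Bk {x y} → x ∈ points Bk → y ∈ points Bk → group x ≡ group y → x ≡ y
  transverse (vertical g B) x∈ y∈ p with ∈-map⁻ _ x∈ | ∈-map⁻ _ y∈
  ... | inj₁ _ , _ , refl | inj₁ _ , _ , refl = group-sameLevel-injective p
  ... | inj₂ _ , _ , refl | inj₂ _ , _ , refl = refl
  transverse (onLine c i β) {cell g a w} {cell g′ a′ w′} x∈ y∈ p with g Fin.≟ g′
  ... | yes refl = onLine-sameLevel c x∈ y∈
  ... | no g≢g′ = ⊥-elim (onLine-newGroup c g≢g′ p x∈ y∈)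
  transverse (onLine c i β) {extra _ _} {extra _ _} x∈ y∈ _ = onLine-extra c x∈ y∈
  transverse (onLine c i β) {∞} x∈ _ _ = ⊥-elim (∞-∉-onLine c x∈)
  transverse (onLine c i β) {y = ∞} _ y∈ _ = ⊥-elim (∞-∉-onLine c y∈)

  Both : Point → Point → Block → Set
  Both x y Bk = x ∈ points Bk × y ∈ points Bk

  pairs-sameLevel : ∀ {g a a′ w w′} → group (cell g a w) ≢ group (cell g a′ w′) →
    ∃! _≡_ (Both (cell g a w) (cell g a′ w′))
  pairs-sameLevel {g} {a} {a′} {w} {w′} p = ∃!-image (vertical g) onto
    (∃!-cong (λ (q∈ , q′∈) → ∈-map⁺ (onLevel g) q∈ , ∈-map⁺ (onLevel g) q′∈)
             (λ (x∈ , y∈) → proj₂ (cell-∈-onLevel⁻ x∈) , proj₂ (cell-∈-onLevel⁻ y∈))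
             (P.pairs λ { refl → p refl }))
    where
    onto : ∀ {Bk} → Both (cell g a w) (cell g a′ w′) Bk → ∃ λ B → vertical g B ≡ Bk
    onto {onLine c _ _} (x∈ , y∈) = ⊥-elim (p (cong group (onLine-sameLevel c x∈ y∈)))
    onto {vertical _ B} (x∈ , _) with cell-∈-onLevel⁻ x∈
    ... | refl , _ = B , refl

  pairs-onLine : ∀ c {i g g′ a a′ w w′} → g ≢ g′ → group (cell g a w) ≢ group (cell g′ a′ w′) →
    point c i g ≡ a → point c i g′ ≡ a′ → ∃! _≡_ (Both (cell g a w) (cell g′ a′ w′) ∘ onLine c i)
  pairs-onLine (extraClass _) g≢g′ _ q q′ =
    ∃!-cong (λ (p∈ , p′∈) → cell-∈-inflate⁺ q p∈ , cell-∈-inflate⁺ q′ p′∈)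
            (λ (x∈ , y∈) → proj₂ (cell-∈-inflate⁻ x∈) , proj₂ (cell-∈-inflate⁻ y∈))
            (G.pairs λ { refl → g≢g′ refl })
  pairs-onLine (groupClass w₀) {g = g} {g′} {w = w} {w′} g≢g′ p q q′ =
    ∃!-cong (λ (r , r′) → cell-∈-cells⁺ q r , cell-∈-cells⁺ q′ r′)
            (λ (x∈ , y∈) → proj₂ (cell-∈-cells⁻ x∈) , proj₂ (cell-∈-cells⁻ y∈))
            (∃!-suc constantRow (OrthogonalArray.pairs (Sʷ w₀) g≢g′ _ _))
    where
    open OrthogonalArray (Sʷ w₀) using (entry)
    -- Two cells matching the omitted constant row lie in the same new group.
    constantRow : ¬ (entry zero g ≡ w × entry zero g′ ≡ w′)
    constantRow (r , r′)
      with trans (sym r) (normalise-constant S zero w₀ _) | trans (sym r′) (normalise-constant S zero w₀ _)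
    ... | refl | refl = p (trans (group-onLine q) (sym (group-onLine q′)))
  pairs-onLine (plainClass _) g≢g′ _ q q′ =
    ∃!-cong (λ (r , r′) → cell-∈-cells⁺ q r , cell-∈-cells⁺ q′ r′)
            (λ (x∈ , y∈) → proj₂ (cell-∈-cells⁻ x∈) , proj₂ (cell-∈-cells⁻ y∈))
            (S.pairs g≢g′ _ _)

  pairs-distinctLevels : ∀ {g g′ a a′ w w′} → g ≢ g′ → group (cell g a w) ≢ group (cell g′ a′ w′) →
    ∃! _≡_ (Both (cell g a w) (cell g′ a′ w′))
  pairs-distinctLevels {g} {g′} {a} {a′} {w} {w′} g≢g′ p with joining g≢g′ a a′
  ... | (c , i) , (q , q′) , unique = ∃!-image (onLine c i) onto (pairs-onLine c g≢g′ p q q′)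
    where
    onto : ∀ {Bk} → Both (cell g a w) (cell g′ a′ w′) Bk → ∃ λ β → onLine c i β ≡ Bk
    onto {onLine c′ i′ β} (x∈ , y∈) with unique (cell-∈-onLine c′ x∈ , cell-∈-onLine c′ y∈)
    ... | refl = β , refl
    onto {vertical _ _} (x∈ , y∈) with cell-∈-onLevel⁻ x∈ | cell-∈-onLevel⁻ y∈
    ... | refl , _ | refl , _ = ⊥-elim (g≢g′ refl)

  pairs-extra : ∀ {g a w s e} → ∃! _≡_ (Both (cell g a w) (extra s e))
  pairs-extra {g} {a} {w} {s} {e} = ∃!-image (onLine (extraClass s) (blockAt (extraClass s) g a)) onto
    (∃!-cong (λ (p∈ , q∈) → cell-∈-inflate⁺ (point-blockAt _ g a) p∈ , ∈-map⁺ _ q∈)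
             (λ (x∈ , y∈) → proj₂ (cell-∈-inflate⁻ x∈) , proj₂ (extra-∈-inflate⁻ y∈))
             (G.pairs λ ()))
    where
    onto : ∀ {Bk} → Both (cell g a w) (extra s e) Bk → ∃ λ B →
      onLine (extraClass s) (blockAt (extraClass s) g a) B ≡ Bk
    onto {onLine c i β} (x∈ , y∈) with extra-∈-onLine c y∈
    ... | refl with blockAt-unique i (cell-∈-onLine c x∈)
    ... | refl = β , refl
    onto {vertical _ _} (_ , y∈) = ⊥-elim (extra-∉-onLevel y∈)

  pairs-∞ : ∀ {g a w} → ∃! _≡_ (Both (cell g a w) ∞)
  pairs-∞ {g} {a} {w} = ∃!-image (vertical g) onto
    (∃!-cong (λ (p∈ , q∈) → ∈-map⁺ (onLevel g) p∈ , ∈-map⁺ (onLevel g) q∈)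
             (λ (x∈ , y∈) → proj₂ (cell-∈-onLevel⁻ x∈) , ∞-∈-onLevel⁻ y∈)
             (P.pairs λ ()))
    where
    onto : ∀ {Bk} → Both (cell g a w) ∞ Bk → ∃ λ B → vertical g B ≡ Bk
    onto {onLine c _ _} (_ , y∈) = ⊥-elim (∞-∉-onLine c y∈)
    onto {vertical _ B} (x∈ , _) with cell-∈-onLevel⁻ x∈
    ... | refl , _ = B , refl

  pairs : ∀ {x y} → group x ≢ group y → ∃! _≡_ (Both x y)
  pairs {cell g _ _} {cell g′ _ _} p with g Fin.≟ g′
  ... | yes refl = pairs-sameLevel p
  ... | no g≢g′ = pairs-distinctLevels g≢g′ p
  pairs {cell _ _ _} {extra _ _} _ = pairs-extra
  pairs {cell _ _ _} {∞} _ = pairs-∞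
  pairs {extra _ _} {cell _ _ _} _ = ∃!-swap pairs-extra
  pairs {∞} {cell _ _ _} _ = ∃!-swap pairs-∞
  pairs {extra _ _} {extra _ _} p = ⊥-elim (p refl)
  pairs {extra _ _} {∞} p = ⊥-elim (p refl)
  pairs {∞} {extra _ _} p = ⊥-elim (p refl)
  pairs {∞} {∞} p = ⊥-elim (p refl)

  inflate-injective : ∀ {s i} → Injective _≡_ _≡_ (inflate s i)
  inflate-injective {x = inj₁ _} {inj₁ _} refl = refl
  inflate-injective {x = inj₂ _} {inj₂ _} refl = refl
  inflate-injective {x = inj₁ _} {inj₂ _} ()
  inflate-injective {x = inj₂ _} {inj₁ _} ()

  onLevel-injective : ∀ {g} → Injective _≡_ _≡_ (onLevel g)
  onLevel-injective {x = inj₁ _} {inj₁ _} refl = refl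
  onLevel-injective {x = inj₂ _} {inj₂ _} refl = refl
  onLevel-injective {x = inj₁ _} {inj₂ _} ()
  onLevel-injective {x = inj₂ _} {inj₁ _} ()

  cells-unique : ∀ c i h → Unique (cells c i h)
  cells-unique c i h = Unique.map⁺ (λ { refl → refl }) (Unique.allFin⁺ ℓ)

  cells-size : ∀ c i h → K (length (cells c i h))
  cells-size c i h = subst K (sym (trans (List.length-map _ (allFin ℓ)) (List.length-tabulate id))) Kℓ

  design : Design K group
  design = record
    { Block = Block
    ; points = points
    ; points-unique = λ
      { (onLine (extraClass _) _ B) → Unique.map⁺ inflate-injective (G.points-unique B)
      ; (onLine (groupClass _) _ _) → cells-unique _ _ _
      ; (onLine (plainClass _) _ _) → cells-unique _ _ _
      ; (vertical _ B) → Unique.map⁺ onLevel-injective (P.points-unique B) }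
    ; points-size = λ
      { (onLine (extraClass _) _ B) → subst K (sym (List.length-map _ (G.points B))) (G.points-size B)
      ; (onLine (groupClass _) _ _) → cells-size _ _ _
      ; (onLine (plainClass _) _ _) → cells-size _ _ _
      ; (vertical _ B) → subst K (sym (List.length-map _ (P.points B))) (P.points-size B) }
    ; transverse = transverse
    ; pairs = pairs }

  point-finite : Finite Point
  point-finite = ↔-finite split
    (⊎-finite (×-finite Fin-finite (×-finite Fin-finite Fin-finite))
              (⊎-finite (×-finite Fin-finite Fin-finite) ⊤-finite))
    where
    split : Point ↔ ((Fin ℓ × (Fin m × Fin u)) ⊎ ((Fin t × Fin v) ⊎ ⊤))
    split = mk↔ₛ′
      (λ { (cell g a w) → inj₁ (g , a , w) ; (extra s e) → inj₂ (inj₁ (s , e)) ; ∞ → inj₂ (inj₂ tt) })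
      (λ { (inj₁ (g , a , w)) → cell g a w ; (inj₂ (inj₁ (s , e))) → extra s e ; (inj₂ (inj₂ _)) → ∞ })
      (λ { (inj₁ _) → refl ; (inj₂ (inj₁ _)) → refl ; (inj₂ (inj₂ _)) → refl })
      (λ { (cell _ _ _) → refl ; (extra _ _) → refl ; ∞ → refl })

  block-finite : Finite G.Block → Finite P.Block → Finite Block
  block-finite G-finite P-finite = ↔-finite split
    (⊎-finite (⊎-finite (×-finite Fin-finite (×-finite Fin-finite G-finite))
                        (⊎-finite (×-finite Fin-finite (×-finite Fin-finite Fin-finite))
                                  (×-finite Fin-finite (×-finite Fin-finite Fin-finite))))
              (×-finite Fin-finite P-finite))
    where
    split : Block ↔ (((Fin t × (Fin m × G.Block)) ⊎ ((Fin u × (Fin m × Fin b)) ⊎ (Fin z × (Fin m × Fin (suc b)))))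
                     ⊎ (Fin ℓ × P.Block))
    split = mk↔ₛ′
      (λ { (onLine (extraClass s) i B) → inj₁ (inj₁ (s , i , B))
         ; (onLine (groupClass w) i r) → inj₁ (inj₂ (inj₁ (w , i , r)))
         ; (onLine (plainClass x) i r) → inj₁ (inj₂ (inj₂ (x , i , r)))
         ; (vertical g B) → inj₂ (g , B) })
      (λ { (inj₁ (inj₁ (s , i , B))) → onLine (extraClass s) i B
         ; (inj₁ (inj₂ (inj₁ (w , i , r)))) → onLine (groupClass w) i r
         ; (inj₁ (inj₂ (inj₂ (x , i , r)))) → onLine (plainClass x) i r
         ; (inj₂ (g , B)) → vertical g B })
      (λ { (inj₁ (inj₁ _)) → refl ; (inj₁ (inj₂ (inj₁ _))) → refl ; (inj₁ (inj₂ (inj₂ _))) → refl ; (inj₂ _) → refl })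
      (λ { (onLine (extraClass _) _ _) → refl ; (onLine (groupClass _) _ _) → refl
         ; (onLine (plainClass _) _ _) → refl ; (vertical _ _) → refl })

  groups : Group ↔ Fin (suc (m * u))
  groups = mk↔ₛ′
    (λ { old → zero ; (new i w) → suc (combine i w) })
    (λ { zero → old ; (suc j) → new (proj₁ (remQuot {m} u j)) (proj₂ (remQuot {m} u j)) })
    (λ { zero → refl ; (suc j) → cong suc (Fin.combine-remQuot {m} u j) })
    (λ { old → refl ; (new i w) → cong (λ (i , w) → new i w) (Fin.remQuot-combine i w) })

  groupSize : Group → ℕ
  groupSize (new _ _) = ℓ
  groupSize old = t * v + 1

  fibre↔ : ∀ γ → Fibre group γ ↔ Fin (groupSize γ)
  fibre↔ (new i w) = mk↔ₛ′
    (λ { (cell g _ _ , _) → g ; (extra _ _ , ()) ; (∞ , ()) })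
    (λ g → cell g (point (groupClass w) i g) w , group-onLine refl)
    (λ _ → refl)
    (λ { (cell g a w′ , p) → fibre-≡ (↔Fin⇒UIP groups) (group-sameLevel-injective (trans (group-onLine refl) (sym p)))
       ; (extra _ _ , ()) ; (∞ , ()) })
  fibre↔ old = ↔-trans split (↔-sym (↔-trans Fin.+↔⊎ (Fin.*↔× ⊎-↔ Fin.1↔⊤)))
    where
    split : Fibre group old ↔ ((Fin t × Fin v) ⊎ ⊤)
    split = mk↔ₛ′
      (λ { (extra s e , _) → inj₁ (s , e) ; (∞ , _) → inj₂ tt ; (cell _ _ _ , ()) })
      (λ { (inj₁ (s , e)) → extra s e , refl ; (inj₂ _) → ∞ , refl })
      (λ { (inj₁ _) → refl ; (inj₂ _) → refl })
      (λ { (extra _ _ , _) → fibre-≡ (↔Fin⇒UIP groups) refl ; (∞ , _) → fibre-≡ (↔Fin⇒UIP groups) refl })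

  result : Finite G.Block → Finite P.Block → GDD K ((ℓ ^^ (m * u)) ++ ((t * v + 1) ^^ 1))
  result G-finite P-finite = toGDD design point-finite (block-finite G-finite P-finite) groups groupSize fibre↔
    (subst (_↭ (ℓ ^^ (m * u)) ++ ((t * v + 1) ^^ 1)) (cong (t * v + 1 ∷_) (sym (tabulate-const (m * u) ℓ)))
           (Perm.++-comm ((t * v + 1) ^^ 1) (ℓ ^^ (m * u))))

cellsOr∞ : ∀ {m u} → Fin (m * u + 1) ↔ ((Fin m × Fin u) ⊎ ⊤)
cellsOr∞ = ↔-trans Fin.+↔⊎ (Fin.*↔× ⊎-↔ Fin.1↔⊤)

splitColumns : ∀ {m u t} → u ≤ m → t ≤ m ∸ u → t + (u + (m ∸ (t + u))) ≡ m
splitColumns {m} {u} {t} u≤m t≤m∸u =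
  trans (sym (ℕ.+-assoc t u _)) (ℕ.m+[n∸m]≡n (ℕ.m≤o∸n⇒m+n≤o t u≤m t≤m∸u))

theorem1 : (ℓ m u v : ℕ) → 0 < ℓ → 0 < m → 0 < u → 0 < v → u ≤ m →
    (K : ℕ → Set) → ((k : ℕ) → K k → 2 ≤ k) → K ℓ →
    TD (ℓ + 1) m → TD ℓ u → GDD K ((u ^^ ℓ) ++ (v ^^ 1)) → PBD (m * u + 1) K →
    (t : ℕ) → t ≤ m ∸ u →
    GDD K ((ℓ ^^ (m * u)) ++ ((t * v + 1) ^^ 1))
theorem1 ℓ m u v 0<ℓ _ 0<u _ u≤m K K≥2 Kℓ T S G P t t≤m∸u =
  Construction.result Kℓ R (proj₂ S′) (uvDesign G) P′ Fin-finite Fin-finite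
  where
  R : ResolvedTD (Class t u (m ∸ (t + u))) ℓ m
  R = resolve (designOA (tdDesign (subst (λ k → TD k m) (ℕ.+-comm ℓ 1) T)))
              (↔-trans classes (cast-id (splitColumns u≤m t≤m∸u))) (fromℕ< 0<ℓ)
  S′ : ∃ λ b → OrthogonalArray ℓ u (Fin (suc b))
  S′ = sucRows (K≥2 ℓ Kℓ) 0<u (designOA (tdDesign S))
  P′ : Design K (id {A = (Fin m × Fin u) ⊎ ⊤})
  P′ = transport {δ = id} cellsOr∞ (to cellsOr∞) (to-injective cellsOr∞) (λ _ → refl) (pbdDesign P)
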